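{- Let $s,t\ge 1$ be integers. Then $\chi_p(P_{2t}\Diamond_2 C_{4s})\le 3$ if $t=1$, $\chi_p(P_{2t}\Diamond_2 C_{4s})\le 4$ if $2\le t\le 3$, and $\chi_p(P_{2t}\Diamond_2 C_{4s})\le 5$ if $t\ge 4$. Moreover, equality holds for $t\in\{1,2,3\}$.
   Context: A packing $k$-coloring of a graph $H$ is a map $c:V(H)\to\{1,\ldots,k\}$ such that any two distinct vertices $u,v$ with $c(u)=c(v)=i$ satisfy $d_H(u,v)\ge i+1$ (distance in $H$). The packing chromatic number $\chi_p(H)$ is the least $k$ for which a packing $k$-coloring exists. $P_m$ denotes the path $v_1\cdots v_m$ and $C_n$ the cycle on $n$ vertices. Path-aligned product: for positive integers $\ell\mid m$ and a connected vertex-transitive graph $G$ containing $P_\ell$ as a subgraph, $P_m\Diamond_\ell G$ is formed from the path $P_m=v_1\cdots v_m$ and $m/\ell$ pairwise disjoint copies of $G$, where for each $1\le i\le m/\ell$ the consecutive path vertices $v_{(i-1)\ell+1},\ldots,v_{i\ell}$ are identified, in order, with the vertices of a path $P_\ell$ (i.e. $\ell$ consecutive cycle vertices when $G$ is a cycle) in the $i$-th copy of $G$. -}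

module Defs where

open import Data.Nat using (ℕ; zero; suc; _≤_; _<_; _∸_; _*_)
open import Data.Fin using (Fin; toℕ)
open import Data.Product using (Σ; ∃; _×_; _,_)
open import Data.Sum using (_⊎_)
open import Relation.Binary.PropositionalEquality using (_≡_; _≢_)
open import Relation.Nullary using (¬_)

data Walk {V : Set} (E : V → V → Set) : V → V → ℕ → Set where
  here : ∀ {u} → Walk E u u 0
  step : ∀ {u v w n} → E u v → Walk E v w n → Walk E u w (suc n)

DistLe : {V : Set} (E : V → V → Set) → V → V → ℕ → Set
DistLe E u v k = ∃ λ n → n ≤ k × Walk E u v n

-- Packing k-coloring; the colour Fin value c stands for colour toℕ c + 1 ∈ {1..k}.
-- Same colour i on distinct u,v  ⇒  d(u,v) ≥ i+1, i.e. ¬ (d(u,v) ≤ i).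
IsPackingColoring : {V : Set} (E : V → V → Set) (k : ℕ) → (V → Fin k) → Set
IsPackingColoring E k c =
  ∀ u v → u ≢ v → c u ≡ c v → ¬ DistLe E u v (suc (toℕ (c u)))

PackingColorable : {V : Set} (E : V → V → Set) → ℕ → Set
PackingColorable {V} E k = Σ (V → Fin k) (IsPackingColoring E k)

PackingChromaticNumber : {V : Set} (E : V → V → Set) → ℕ → Set
PackingChromaticNumber E k =
  PackingColorable E k × (∀ m → m < k → ¬ PackingColorable E m)

CycAdj : (n : ℕ) → Fin n → Fin n → Set
CycAdj n j j' =
  (toℕ j' ≡ suc (toℕ j)) ⊎ (toℕ j ≡ suc (toℕ j')) ⊎
  (toℕ j ≡ n ∸ 1 × toℕ j' ≡ 0) ⊎ (toℕ j' ≡ n ∸ 1 × toℕ j ≡ 0)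

-- Vertex set of P_{2t} ◇_2 C_n : copy i ∈ Fin t of C_n, cycle vertex j ∈ Fin n.
-- Path vertices v_{2i+1}, v_{2i+2} (1-based) are identified with cycle vertices 0,1
-- of copy i (0-based); the remaining path edges v_{2i+2} v_{2i+3} join
-- vertex 1 of copy i with vertex 0 of copy i+1.
PDV : ℕ → ℕ → Set
PDV t n = Fin t × Fin n

PDAdj : (t n : ℕ) → PDV t n → PDV t n → Set
PDAdj t n (i , j) (i' , j') =
  (i ≡ i' × CycAdj n j j') ⊎
  (toℕ i' ≡ suc (toℕ i) × toℕ j ≡ 1 × toℕ j' ≡ 0) ⊎
  (toℕ i ≡ suc (toℕ i') × toℕ j ≡ 0 × toℕ j' ≡ 1)

{-# OPTIONS --safe #-}
module Submission where

-- Colour vertex j ≠ 0 of every cycle with 2, 1, 3, 1 according to j mod 4, and vertex 0 of the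
-- i-th copy with 2, 4, 2, 5 according to i mod 4: three colours suffice for t = 1, four for t ≤ 3.
-- As 4 divides the cycle length, every edge changes the cycle position by ±1 mod 4.  So the
-- vertices of colour 1, all at odd positions, are independent; two vertices of colour 2, or of
-- colour 3, have equal positions mod 4, hence are joined by no walk of odd length, and a walk of
-- length two between them must be the detour through a bridge joining the vertices 0 of
-- consecutive copies, which never both have colour 2.  Finally 2i + [j ≠ 0] changes by at most
-- one along an edge, so the vertices 0 of distinct copies i ≡ i' mod 4 are at distance ≥ 8.
--
-- Conversely, C_{4s} contains a path on four vertices, which has no packing 2-colouring.  For
-- t ≥ 2, both ends of the bridge between copies 0 and 1 have three neighbours, so in a packing
-- 3-colouring neither has colour 1 (two of its neighbours would share colour 2 or 3).  Hence the
-- ends have colours 2 and 3, and the end of colour 3 starts a path on four vertices through the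
-- other end, which cannot be packing 3-coloured starting with 3, 2.

open import Defs
open import Data.Bool using (Bool; true; false; not; _xor_)
open import Data.Bool.Properties using (not-¬; not-involutive; not-distribˡ-xor; not-distribʳ-xor)
open import Data.Empty using (⊥; ⊥-elim)
open import Data.Fin using (Fin; zero; suc; toℕ; fromℕ; fromℕ<; inject≤)
open import Data.Fin.Properties
  using (toℕ-fromℕ; toℕ-fromℕ<; toℕ-injective; toℕ<n; toℕ-inject≤; inject≤-injective)
open import Data.Nat using (ℕ; zero; suc; _+_; _*_; _∸_; _≤_; _<_; z≤n; s≤s; ∣_-_∣)
open import Data.Nat.Properties
  using (≤-refl; ≤-trans; ≤-reflexive; ≤-pred; <⇒≤; ≤⇒≯; n≤1+n; <-irrefl; suc-injective; 0≢1+n; 1+n≢n;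
         n≤0⇒n≡0; m≤m+n; m≤m*n; m+[n∸m]≡n; ∸-monoˡ-≤; +-mono-≤; *-suc; *-cancelˡ-<;
         ∣n-n∣≡0; ∣-∣-comm; ∣-∣-triangle; *-distribˡ-∣-∣)
open import Data.Product using (_×_; _,_; proj₂)
open import Data.Sum using (_⊎_; inj₁; inj₂; [_,_]′; map₂; fromInj₂)
open import Function using (_∘_; case_of_)
open import Relation.Binary.Definitions using (Symmetric; Irreflexive)
open import Relation.Binary.PropositionalEquality
  using (_≡_; _≢_; refl; sym; trans; cong; cong₂; subst; module ≡-Reasoning)
open import Relation.Nullary using (¬_)

odd : ℕ → Bool
odd zero    = false
odd (suc n) = not (odd n)

module _ {V : Set} {E : V → V → Set} where

  walk-lipschitz : (f : V → ℕ) → (∀ {x y} → E x y → ∣ f x - f y ∣ ≤ 1) →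
                   ∀ {u v d} → Walk E u v d → ∣ f u - f v ∣ ≤ d
  walk-lipschitz f f-edge {u} here = ≤-reflexive (∣n-n∣≡0 (f u))
  walk-lipschitz f f-edge {u} {v} (step {v = w} e p) =
    ≤-trans (∣-∣-triangle (f u) (f w) (f v)) (+-mono-≤ (f-edge e) (walk-lipschitz f f-edge p))

  module _ (side : V → Bool) (flips : ∀ {x y} → E x y → side y ≡ not (side x)) where

    walk-side : ∀ {u v d} → Walk E u v d → side v ≡ odd d xor side u
    walk-side here = refl
    walk-side {u} {v} (step {v = w} {n = d} e p) = begin
      side v                  ≡⟨ walk-side p ⟩
      odd d xor side w        ≡⟨ cong (odd d xor_) (flips e) ⟩
      odd d xor not (side u)  ≡⟨ not-distribʳ-xor (odd d) (side u) ⟨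
      not (odd d xor side u)  ≡⟨ not-distribˡ-xor (odd d) (side u) ⟩
      not (odd d) xor side u  ∎
      where open ≡-Reasoning

    odd-walk-changes-side : ∀ {u v d} → Walk E u v d → odd d ≡ true → side u ≢ side v
    odd-walk-changes-side {u} p odd-d same =
      not-¬ (sym same) (trans (walk-side p) (cong (_xor side u) odd-d))

  packingColorable-mono : ∀ {m k} → m ≤ k → PackingColorable E m → PackingColorable E k
  packingColorable-mono m≤k (c , pc) = (λ v → inject≤ (c v) m≤k) , λ u v u≢v same dist →
    pc u v u≢v (inject≤-injective m≤k m≤k (c u) (c v) same)
       (subst (λ x → DistLe E u v (suc x)) (toℕ-inject≤ (c u) m≤k) dist)

  packingChromaticNumber-intro : ∀ {k} → PackingColorable E (suc k) → ¬ PackingColorable E k →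
                                 PackingChromaticNumber E (suc k)
  packingChromaticNumber-intro colourable ¬colourable =
    colourable , λ m m<1+k → ¬colourable ∘ packingColorable-mono (≤-pred m<1+k)

  packingColorable-fromℕ : ∀ {K} (col : V → ℕ) → (∀ v → col v < K) →
                           (∀ u v → u ≢ v → col u ≡ col v → ¬ DistLe E u v (suc (col u))) →
                           PackingColorable E K
  packingColorable-fromℕ {K} col col<K packed = c , λ u v u≢v same dist →
    packed u v u≢v (trans (sym (toℕ-c u)) (trans (cong toℕ same) (toℕ-c v)))
      (subst (λ x → DistLe E u v (suc x)) (toℕ-c u) dist)
    where
    c : V → Fin K
    c v = fromℕ< (col<K v)
    toℕ-c : ∀ v → toℕ (c v) ≡ col v
    toℕ-c v = toℕ-fromℕ< (col<K v)

module _ {V : Set} {E : V → V → Set} {k : ℕ} {c : V → Fin k} (pc : IsPackingColoring E k c) where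

  short-walk-conflict : ∀ {u v d} x → c u ≡ x → c v ≡ x → u ≢ v → Walk E u v d → d ≤ suc (toℕ x) → ⊥
  short-walk-conflict x cu cv u≢v p d≤ =
    pc _ _ u≢v (trans cu (sym cv)) (_ , subst (λ y → _ ≤ suc (toℕ y)) (sym cu) d≤ , p)

  adjacent-colours-differ : Irreflexive _≡_ E → ∀ {u v} → E u v → c u ≢ c v
  adjacent-colours-differ irr e same = pc _ _ (λ u≡v → irr u≡v e) same (1 , s≤s z≤n , step e here)

  co-neighbours-colours-differ : Symmetric E → ∀ {w x y a} → c x ≡ a → c y ≡ a → x ≢ y →
                                 E w x → E w y → 1 ≤ toℕ a → ⊥
  co-neighbours-colours-differ sym-E {a = a} cx cy x≢y wx wy 1≤a =
    short-walk-conflict a cx cy x≢y (step (sym-E wx) (step wy here)) (s≤s 1≤a)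

module _ {V : Set} {E : V → V → Set} (irr : Irreflexive _≡_ E) where

  path-not-packing-2-colourable : ∀ {c : V → Fin 2} {x₀ x₁ x₂ x₃} → IsPackingColoring E 2 c →
                                  E x₀ x₁ → E x₁ x₂ → E x₂ x₃ → x₀ ≢ x₂ → x₁ ≢ x₃ → ⊥
  path-not-packing-2-colourable {c} {x₀} {x₁} {x₂} {x₃} pc e₀₁ e₁₂ e₂₃ x₀≢x₂ x₁≢x₃
    with c x₀ in c₀ | c x₁ in c₁ | c x₂ in c₂ | c x₃ in c₃
  ... | _        | zero     | zero     | _        = adjacent-colours-differ pc irr e₁₂ (trans c₁ (sym c₂))
  ... | _        | suc zero | suc zero | _        = adjacent-colours-differ pc irr e₁₂ (trans c₁ (sym c₂))
  ... | zero     | zero     | suc zero | _        = adjacent-colours-differ pc irr e₀₁ (trans c₀ (sym c₁))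
  ... | _        | suc zero | zero     | zero     = adjacent-colours-differ pc irr e₂₃ (trans c₂ (sym c₃))
  ... | suc zero | zero     | suc zero | _        =
    short-walk-conflict pc (suc zero) c₀ c₂ x₀≢x₂ (step e₀₁ (step e₁₂ here)) ≤-refl
  ... | _        | suc zero | zero     | suc zero =
    short-walk-conflict pc (suc zero) c₁ c₃ x₁≢x₃ (step e₁₂ (step e₂₃ here)) ≤-refl

  claw-centre-colour≢0 : Symmetric E → ∀ {c : V → Fin 3} {w x y z} → IsPackingColoring E 3 c →
                         E w x → E w y → E w z → x ≢ y → x ≢ z → y ≢ z → c w ≢ zero
  claw-centre-colour≢0 sym-E {c} {w} {x} {y} {z} pc wx wy wz x≢y x≢z y≢z cw
    with c x in cx | c y in cy | c z in cz
  ... | zero | _    | _    = adjacent-colours-differ pc irr wx (trans cw (sym cx))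
  ... | _    | zero | _    = adjacent-colours-differ pc irr wy (trans cw (sym cy))
  ... | _    | _    | zero = adjacent-colours-differ pc irr wz (trans cw (sym cz))
  ... | suc zero       | suc zero       | _              =
    co-neighbours-colours-differ pc sym-E cx cy x≢y wx wy (s≤s z≤n)
  ... | suc (suc zero) | suc (suc zero) | _              =
    co-neighbours-colours-differ pc sym-E cx cy x≢y wx wy (s≤s z≤n)
  ... | suc zero       | suc (suc zero) | suc zero       =
    co-neighbours-colours-differ pc sym-E cx cz x≢z wx wz (s≤s z≤n)
  ... | suc (suc zero) | suc zero       | suc (suc zero) =
    co-neighbours-colours-differ pc sym-E cx cz x≢z wx wz (s≤s z≤n)
  ... | suc zero       | suc (suc zero) | suc (suc zero) =
    co-neighbours-colours-differ pc sym-E cy cz y≢z wy wz (s≤s z≤n)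
  ... | suc (suc zero) | suc zero       | suc zero       =
    co-neighbours-colours-differ pc sym-E cy cz y≢z wy wz (s≤s z≤n)

  path-cannot-start-with-colours-2-1 : ∀ {c : V → Fin 3} {x₀ x₁ x₂ x₃} → IsPackingColoring E 3 c →
                                       c x₀ ≡ suc (suc zero) → c x₁ ≡ suc zero →
                                       E x₀ x₁ → E x₁ x₂ → E x₂ x₃ → x₀ ≢ x₂ → x₀ ≢ x₃ → x₁ ≢ x₃ → ⊥
  path-cannot-start-with-colours-2-1 {c} {x₀} {x₁} {x₂} {x₃} pc c₀ c₁ e₀₁ e₁₂ e₂₃ x₀≢x₂ x₀≢x₃ x₁≢x₃
    with c x₂ in c₂ | c x₃ in c₃
  ... | suc zero       | _              = adjacent-colours-differ pc irr e₁₂ (trans c₁ (sym c₂))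
  ... | suc (suc zero) | _              =
    short-walk-conflict pc (suc (suc zero)) c₀ c₂ x₀≢x₂ (step e₀₁ (step e₁₂ here)) (s≤s (s≤s z≤n))
  ... | zero           | zero           = adjacent-colours-differ pc irr e₂₃ (trans c₂ (sym c₃))
  ... | zero           | suc zero       =
    short-walk-conflict pc (suc zero) c₁ c₃ x₁≢x₃ (step e₁₂ (step e₂₃ here)) ≤-refl
  ... | zero           | suc (suc zero) =
    short-walk-conflict pc (suc (suc zero)) c₀ c₃ x₀≢x₃ (step e₀₁ (step e₁₂ (step e₂₃ here))) ≤-refl

-- Orientation of PDAdj in which every edge raises the cycle position by one (mod n); a bridge
-- runs from vertex 0 of copy i + 1 to vertex 1 of copy i.
data Step {t n : ℕ} : PDV t n → PDV t n → Set where
  along  : ∀ {i j j′} → toℕ j′ ≡ suc (toℕ j) → Step (i , j) (i , j′)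
  wrap   : ∀ {i j j′} → toℕ j ≡ n ∸ 1 → toℕ j′ ≡ 0 → Step (i , j) (i , j′)
  bridge : ∀ {i i′ j j′} → toℕ i ≡ suc (toℕ i′) → toℕ j ≡ 0 → toℕ j′ ≡ 1 → Step (i , j) (i′ , j′)

ConsecutiveEntries : ∀ {t n} → PDV t n → PDV t n → Set
ConsecutiveEntries (i , j) (i′ , j′) =
  toℕ j ≡ 0 × toℕ j′ ≡ 0 × (toℕ i′ ≡ suc (toℕ i) ⊎ toℕ i ≡ suc (toℕ i′))

module _ {t n : ℕ} where

  adj⇒step : ∀ {u v} → PDAdj t n u v → Step u v ⊎ Step v u
  adj⇒step (inj₁ (refl , inj₁ p))                    = inj₁ (along p)
  adj⇒step (inj₁ (refl , inj₂ (inj₁ p)))             = inj₂ (along p)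
  adj⇒step (inj₁ (refl , inj₂ (inj₂ (inj₁ (p , q))))) = inj₁ (wrap p q)
  adj⇒step (inj₁ (refl , inj₂ (inj₂ (inj₂ (p , q))))) = inj₂ (wrap p q)
  adj⇒step (inj₂ (inj₁ (p , q , r)))                 = inj₂ (bridge p r q)
  adj⇒step (inj₂ (inj₂ (p , q , r)))                 = inj₁ (bridge p q r)

  step⇒adj : ∀ {u v} → Step u v → PDAdj t n u v
  step⇒adj (along p)      = inj₁ (refl , inj₁ p)
  step⇒adj (wrap p q)     = inj₁ (refl , inj₂ (inj₂ (inj₁ (p , q))))
  step⇒adj (bridge p q r) = inj₂ (inj₂ (p , q , r))

  step⇒adj˘ : ∀ {u v} → Step u v → PDAdj t n v u
  step⇒adj˘ (along p)      = inj₁ (refl , inj₂ (inj₁ p))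
  step⇒adj˘ (wrap p q)     = inj₁ (refl , inj₂ (inj₂ (inj₂ (p , q))))
  step⇒adj˘ (bridge p q r) = inj₂ (inj₁ (p , r , q))

  PDAdj-sym : Symmetric (PDAdj t n)
  PDAdj-sym e = [ step⇒adj˘ , step⇒adj ]′ (adj⇒step e)

  module _ (2≤n : 2 ≤ n) where

    n∸1≢0 : n ∸ 1 ≢ 0
    n∸1≢0 eq with subst (1 ≤_) eq (∸-monoˡ-≤ 1 2≤n)
    ... | ()

    no-position-after-last : (j : Fin n) → toℕ j ≢ suc (n ∸ 1)
    no-position-after-last j eq =
      <-irrefl (trans eq (m+[n∸m]≡n (≤-trans (s≤s z≤n) 2≤n))) (toℕ<n j)

    step-irreflexive : ∀ {u} → Step {t} {n} u u → ⊥
    step-irreflexive (along p)      = 1+n≢n (sym p)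
    step-irreflexive (wrap p q)     = n∸1≢0 (trans (sym p) q)
    step-irreflexive (bridge p _ _) = 1+n≢n (sym p)

    PDAdj-irreflexive : Irreflexive _≡_ (PDAdj t n)
    PDAdj-irreflexive refl e = [ step-irreflexive , step-irreflexive ]′ (adj⇒step e)

    common-source : ∀ {w i j i′ j′} → Step {t} {n} w (i , j) → Step w (i′ , j′) →
                    (i , j) ≡ (i′ , j′) ⊎ toℕ j ≡ 1
    common-source (along p)      (along q)      = inj₁ (cong (_ ,_) (toℕ-injective (trans p (sym q))))
    common-source (along p)      (wrap q _)     = ⊥-elim (no-position-after-last _ (trans p (cong suc q)))
    common-source (along p)      (bridge _ q _) = inj₂ (trans p (cong suc q))
    common-source (wrap p _)     (along q)      = ⊥-elim (no-position-after-last _ (trans q (cong suc p)))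
    common-source (wrap _ p)     (wrap _ q)     = inj₁ (cong (_ ,_) (toℕ-injective (trans p (sym q))))
    common-source (wrap p _)     (bridge _ q _) = ⊥-elim (n∸1≢0 (trans (sym p) q))
    common-source (bridge _ _ p) _              = inj₂ p

    common-target : ∀ {w i j i′ j′} → Step {t} {n} (i , j) w → Step (i′ , j′) w →
                    (i , j) ≡ (i′ , j′) ⊎ ConsecutiveEntries (i , j) (i′ , j′)
    common-target (along p)      (along q)      =
      inj₁ (cong (_ ,_) (toℕ-injective (suc-injective (trans (sym p) q))))
    common-target (along p)      (wrap _ q)     = ⊥-elim (0≢1+n (trans (sym q) p))
    common-target (along p)      (bridge q r s) = inj₂ (suc-injective (trans (sym p) s) , r , inj₁ q)
    common-target (wrap _ p)     (along q)      = ⊥-elim (0≢1+n (trans (sym p) q))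
    common-target (wrap p _)     (wrap q _)     = inj₁ (cong (_ ,_) (toℕ-injective (trans p (sym q))))
    common-target (wrap _ p)     (bridge _ _ q) = ⊥-elim (0≢1+n (trans (sym p) q))
    common-target (bridge p q r) (along s)      = inj₂ (q , suc-injective (trans (sym s) r) , inj₂ p)
    common-target (bridge _ _ p) (wrap _ q)     = ⊥-elim (0≢1+n (trans (sym q) p))
    common-target (bridge p q _) (bridge r s _) =
      inj₁ (cong₂ _,_ (toℕ-injective (trans p (sym r))) (toℕ-injective (trans q (sym s))))

data ℤ₄ : Set where
  0₄ 1₄ 2₄ 3₄ : ℤ₄

suc₄ : ℤ₄ → ℤ₄
suc₄ 0₄ = 1₄
suc₄ 1₄ = 2₄
suc₄ 2₄ = 3₄
suc₄ 3₄ = 0₄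

pred₄ : ℤ₄ → ℤ₄
pred₄ 0₄ = 3₄
pred₄ 1₄ = 0₄
pred₄ 2₄ = 1₄
pred₄ 3₄ = 2₄

pred₄∘suc₄ : ∀ r → pred₄ (suc₄ r) ≡ r
pred₄∘suc₄ 0₄ = refl
pred₄∘suc₄ 1₄ = refl
pred₄∘suc₄ 2₄ = refl
pred₄∘suc₄ 3₄ = refl

suc₄-injective : ∀ {r r′} → suc₄ r ≡ suc₄ r′ → r ≡ r′
suc₄-injective {r} {r′} eq = trans (sym (pred₄∘suc₄ r)) (trans (cong pred₄ eq) (pred₄∘suc₄ r′))

suc₄∘suc₄≢id : ∀ r → suc₄ (suc₄ r) ≢ r
suc₄∘suc₄≢id 0₄ ()
suc₄∘suc₄≢id 1₄ ()
suc₄∘suc₄≢id 2₄ ()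
suc₄∘suc₄≢id 3₄ ()

odd₄ : ℤ₄ → Bool
odd₄ 0₄ = false
odd₄ 1₄ = true
odd₄ 2₄ = false
odd₄ 3₄ = true

odd₄-suc₄ : ∀ r → odd₄ (suc₄ r) ≡ not (odd₄ r)
odd₄-suc₄ 0₄ = refl
odd₄-suc₄ 1₄ = refl
odd₄-suc₄ 2₄ = refl
odd₄-suc₄ 3₄ = refl

[_]₄ : ℕ → ℤ₄
[ 0 ]₄ = 0₄
[ 1 ]₄ = 1₄
[ 2 ]₄ = 2₄
[ 3 ]₄ = 3₄
[ suc (suc (suc (suc m))) ]₄ = [ m ]₄

[1+m]₄ : ∀ m → [ suc m ]₄ ≡ suc₄ [ m ]₄
[1+m]₄ 0 = refl
[1+m]₄ 1 = refl
[1+m]₄ 2 = refl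
[1+m]₄ 3 = refl
[1+m]₄ (suc (suc (suc (suc m)))) = [1+m]₄ m

[4[1+k]∸1]₄ : ∀ k → [ 4 * suc k ∸ 1 ]₄ ≡ 3₄
[4[1+k]∸1]₄ zero    = refl
[4[1+k]∸1]₄ (suc k) = trans (cong (λ m → [ m ∸ 1 ]₄) (*-suc 4 (suc k))) ([4[1+k]∸1]₄ k)

[]₄-injective-within-3 : ∀ {a b} → ∣ a - b ∣ ≤ 3 → [ a ]₄ ≡ [ b ]₄ → a ≡ b
[]₄-injective-within-3 {0} {0} _ _ = refl
[]₄-injective-within-3 {0} {1} _ ()
[]₄-injective-within-3 {0} {2} _ ()
[]₄-injective-within-3 {0} {3} _ ()
[]₄-injective-within-3 {0} {suc (suc (suc (suc _)))} (s≤s (s≤s (s≤s ()))) _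
[]₄-injective-within-3 {1} {0} _ ()
[]₄-injective-within-3 {2} {0} _ ()
[]₄-injective-within-3 {3} {0} _ ()
[]₄-injective-within-3 {suc (suc (suc (suc _)))} {0} (s≤s (s≤s (s≤s ()))) _
[]₄-injective-within-3 {suc a} {suc b} a≈b eq =
  cong suc ([]₄-injective-within-3 a≈b (suc₄-injective (trans (sym ([1+m]₄ a)) (trans eq ([1+m]₄ b)))))

∣m-1+m∣≡1 : ∀ m → ∣ m - suc m ∣ ≡ 1
∣m-1+m∣≡1 zero    = refl
∣m-1+m∣≡1 (suc m) = ∣m-1+m∣≡1 m

-- Colour indices, one less than the colours of the paper: cycleColour colours vertex j ≠ 0 of
-- a cycle by j mod 4, entryColour colours vertex 0 of the i-th copy by i mod 4.
cycleColour : ℤ₄ → ℕ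
cycleColour 0₄ = 1
cycleColour 1₄ = 0
cycleColour 2₄ = 2
cycleColour 3₄ = 0

entryColour : ℤ₄ → ℕ
entryColour 0₄ = 1
entryColour 1₄ = 3
entryColour 2₄ = 1
entryColour 3₄ = 4

cycleColour≤2 : ∀ r → cycleColour r ≤ 2
cycleColour≤2 0₄ = s≤s z≤n
cycleColour≤2 1₄ = z≤n
cycleColour≤2 2₄ = ≤-refl
cycleColour≤2 3₄ = z≤n

cycleColour≡0⇒odd : ∀ r → cycleColour r ≡ 0 → odd₄ r ≡ true
cycleColour≡0⇒odd 0₄ ()
cycleColour≡0⇒odd 1₄ _ = refl
cycleColour≡0⇒odd 2₄ ()
cycleColour≡0⇒odd 3₄ _ = refl

cycleColour≡1⇒0₄ : ∀ r → cycleColour r ≡ 1 → r ≡ 0₄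
cycleColour≡1⇒0₄ 0₄ _ = refl
cycleColour≡1⇒0₄ 1₄ ()
cycleColour≡1⇒0₄ 2₄ ()
cycleColour≡1⇒0₄ 3₄ ()

cycleColour≡2⇒2₄ : ∀ r → cycleColour r ≡ 2 → r ≡ 2₄
cycleColour≡2⇒2₄ 0₄ ()
cycleColour≡2⇒2₄ 1₄ ()
cycleColour≡2⇒2₄ 2₄ _ = refl
cycleColour≡2⇒2₄ 3₄ ()

entryColour≤4 : ∀ r → entryColour r ≤ 4
entryColour≤4 0₄ = s≤s z≤n
entryColour≤4 1₄ = s≤s (s≤s (s≤s z≤n))
entryColour≤4 2₄ = s≤s z≤n
entryColour≤4 3₄ = ≤-refl

entryColour≢0 : ∀ r → entryColour r ≢ 0
entryColour≢0 0₄ ()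
entryColour≢0 1₄ ()
entryColour≢0 2₄ ()
entryColour≢0 3₄ ()

entryColour≢2 : ∀ r → entryColour r ≢ 2
entryColour≢2 0₄ ()
entryColour≢2 1₄ ()
entryColour≢2 2₄ ()
entryColour≢2 3₄ ()

entryColour-alternates : ∀ r → entryColour r ≡ 1 → entryColour (suc₄ r) ≢ 1
entryColour-alternates 0₄ _ ()
entryColour-alternates 1₄ ()
entryColour-alternates 2₄ _ ()
entryColour-alternates 3₄ ()

entryColour-injective : ∀ {r r′} → 3 ≤ entryColour r → entryColour r ≡ entryColour r′ → r ≡ r′
entryColour-injective {0₄} (s≤s ())
entryColour-injective {2₄} (s≤s ())
entryColour-injective {1₄} {0₄} _ ()
entryColour-injective {1₄} {1₄} _ _ = refl
entryColour-injective {1₄} {2₄} _ ()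
entryColour-injective {1₄} {3₄} _ ()
entryColour-injective {3₄} {0₄} _ ()
entryColour-injective {3₄} {1₄} _ ()
entryColour-injective {3₄} {2₄} _ ()
entryColour-injective {3₄} {3₄} _ _ = refl

entryColour-first-three : ∀ i → i ≤ 2 → entryColour [ i ]₄ ≤ 3
entryColour-first-three 0 _ = s≤s z≤n
entryColour-first-three 1 _ = ≤-refl
entryColour-first-three 2 _ = s≤s z≤n
entryColour-first-three (suc (suc (suc _))) (s≤s (s≤s ()))

module PackingColouring (t s : ℕ) where

  n : ℕ
  n = 4 * suc s

  G : PDV t n → PDV t n → Set
  G = PDAdj t n

  2≤n : 2 ≤ n
  2≤n = ≤-trans (s≤s (s≤s z≤n)) (m≤m*n 4 (suc s))

  position : PDV t n → ℤ₄
  position (_ , j) = [ toℕ j ]₄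

  step-position : ∀ {u v} → Step u v → position v ≡ suc₄ (position u)
  step-position (along {j = j} p) = trans (cong [_]₄ p) ([1+m]₄ (toℕ j))
  step-position (wrap p q)        =
    trans (cong [_]₄ q) (sym (trans (cong (suc₄ ∘ [_]₄) p) (cong suc₄ ([4[1+k]∸1]₄ s))))
  step-position (bridge _ p q)    = trans (cong [_]₄ q) (sym (cong (suc₄ ∘ [_]₄) p))

  two-step-same-position : ∀ {u w v} → G u w → G w v → position u ≡ position v →
                           u ≡ v ⊎ toℕ (proj₂ u) ≡ 1 ⊎ ConsecutiveEntries u v
  two-step-same-position {u} {w} {v} e e′ same with adj⇒step e | adj⇒step e′
  ... | inj₁ uw | inj₁ wv = ⊥-elim (suc₄∘suc₄≢id (position u) (begin
          suc₄ (suc₄ (position u))  ≡⟨ cong suc₄ (step-position uw) ⟨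
          suc₄ (position w)         ≡⟨ step-position wv ⟨
          position v                ≡⟨ same ⟨
          position u                ∎))
    where open ≡-Reasoning
  ... | inj₂ wu | inj₂ vw = ⊥-elim (suc₄∘suc₄≢id (position v) (begin
          suc₄ (suc₄ (position v))  ≡⟨ cong suc₄ (step-position vw) ⟨
          suc₄ (position w)         ≡⟨ step-position wu ⟨
          position u                ≡⟨ same ⟩
          position v                ∎))
    where open ≡-Reasoning
  ... | inj₁ uw | inj₂ vw = map₂ inj₂ (common-target 2≤n uw vw)
  ... | inj₂ wu | inj₁ wv = map₂ inj₁ (common-source 2≤n wu wv)

  side : PDV t n → Bool
  side = odd₄ ∘ position

  step-flips-side : ∀ {u v} → Step u v → side v ≡ not (side u)
  step-flips-side {u} uv = trans (cong odd₄ (step-position uv)) (odd₄-suc₄ (position u))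

  edge-flips-side : ∀ {u v} → G u v → side v ≡ not (side u)
  edge-flips-side e = [ step-flips-side , flipped ]′ (adj⇒step e)
    where
    flipped : ∀ {u v} → Step v u → side v ≡ not (side u)
    flipped vu = sym (trans (cong not (step-flips-side vu)) (not-involutive _))

  short-walk-same-position : ∀ {u v d} → position u ≡ position v → u ≢ v → Walk G u v d → d ≤ 3 →
                             toℕ (proj₂ u) ≡ 1 ⊎ ConsecutiveEntries u v
  short-walk-same-position _    u≢v here _ = ⊥-elim (u≢v refl)
  short-walk-same-position same _   p@(step _ here) _ =
    ⊥-elim (odd-walk-changes-side side edge-flips-side p refl (cong odd₄ same))
  short-walk-same-position same u≢v (step e (step e′ here)) _ =
    fromInj₂ (⊥-elim ∘ u≢v) (two-step-same-position e e′ same)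
  short-walk-same-position same _   p@(step _ (step _ (step _ here))) _ =
    ⊥-elim (odd-walk-changes-side side edge-flips-side p refl (cong odd₄ same))
  short-walk-same-position _    _   (step _ (step _ (step _ (step _ _)))) (s≤s (s≤s (s≤s ())))

  height : PDV t n → ℕ
  height (i , zero)  = 2 * toℕ i
  height (i , suc _) = suc (2 * toℕ i)

  height-same-copy : ∀ i j j′ → ∣ height (i , j) - height (i , j′) ∣ ≤ 1
  height-same-copy i zero    zero    = ≤-trans (≤-reflexive (∣n-n∣≡0 (2 * toℕ i))) z≤n
  height-same-copy i zero    (suc _) = ≤-reflexive (∣m-1+m∣≡1 (2 * toℕ i))
  height-same-copy i (suc _) zero    =
    ≤-reflexive (trans (∣-∣-comm (suc (2 * toℕ i)) (2 * toℕ i)) (∣m-1+m∣≡1 (2 * toℕ i)))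
  height-same-copy i (suc _) (suc _) = ≤-trans (≤-reflexive (∣n-n∣≡0 (2 * toℕ i))) z≤n

  height-step : ∀ {u v} → Step u v → ∣ height u - height v ∣ ≤ 1
  height-step (along {i} {j} {j′} _)  = height-same-copy i j j′
  height-step (wrap {i} {j} {j′} _ _) = height-same-copy i j j′
  height-step (bridge {i} {i′} {zero} {suc _} p _ _) = ≤-reflexive (begin
    ∣ 2 * toℕ i - suc (2 * toℕ i′) ∣                ≡⟨ cong (λ m → ∣ 2 * m - suc (2 * toℕ i′) ∣) p ⟩
    ∣ 2 * suc (toℕ i′) - suc (2 * toℕ i′) ∣         ≡⟨ cong (∣_- suc (2 * toℕ i′) ∣) (*-suc 2 (toℕ i′)) ⟩
    ∣ suc (suc (2 * toℕ i′)) - suc (2 * toℕ i′) ∣   ≡⟨ ∣-∣-comm (suc (2 * toℕ i′)) (2 * toℕ i′) ⟩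
    ∣ 2 * toℕ i′ - suc (2 * toℕ i′) ∣               ≡⟨ ∣m-1+m∣≡1 (2 * toℕ i′) ⟩
    1                                               ∎)
    where open ≡-Reasoning
  height-step (bridge {j = suc _} _ () _)
  height-step (bridge {j = zero} {j′ = zero} _ _ ())

  height-edge : ∀ {u v} → G u v → ∣ height u - height v ∣ ≤ 1
  height-edge {u} {v} e = [ height-step , flipped ]′ (adj⇒step e)
    where
    flipped : Step v u → ∣ height u - height v ∣ ≤ 1
    flipped vu = subst (_≤ 1) (∣-∣-comm (height v) (height u)) (height-step vu)

  entries-apart : ∀ {i i′ d} → Walk G (i , zero) (i′ , zero) d → 2 * ∣ toℕ i - toℕ i′ ∣ ≤ d
  entries-apart {i} {i′} p =
    subst (_≤ _) (sym (*-distribˡ-∣-∣ 2 (toℕ i) (toℕ i′))) (walk-lipschitz height height-edge p)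

  colour : PDV t n → ℕ
  colour (i , zero)  = entryColour [ toℕ i ]₄
  colour (i , suc j) = cycleColour [ suc (toℕ j) ]₄

  colour≡0⇒odd : ∀ u → colour u ≡ 0 → side u ≡ true
  colour≡0⇒odd (_ , zero)  c≡0 = ⊥-elim (entryColour≢0 _ c≡0)
  colour≡0⇒odd (_ , suc _) c≡0 = cycleColour≡0⇒odd _ c≡0

  colour≡1⇒position≡0 : ∀ u → colour u ≡ 1 → position u ≡ 0₄
  colour≡1⇒position≡0 (_ , zero)  _   = refl
  colour≡1⇒position≡0 (_ , suc _) c≡1 = cycleColour≡1⇒0₄ _ c≡1

  colour≡2⇒position≡2 : ∀ u → colour u ≡ 2 → position u ≡ 2₄
  colour≡2⇒position≡2 (_ , zero)  c≡2 = ⊥-elim (entryColour≢2 _ c≡2)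
  colour≡2⇒position≡2 (_ , suc _) c≡2 = cycleColour≡2⇒2₄ _ c≡2

  consecutive-entries-not-both-colour-1 : ∀ {u v} → ConsecutiveEntries u v → colour u ≡ 1 → colour v ≢ 1
  consecutive-entries-not-both-colour-1 {i , zero} {i′ , zero} (_ , _ , inj₁ p) cu cv =
    entryColour-alternates _ cu
      (subst (λ r → entryColour r ≡ 1) (trans (cong [_]₄ p) ([1+m]₄ (toℕ i))) cv)
  consecutive-entries-not-both-colour-1 {i , zero} {i′ , zero} (_ , _ , inj₂ p) cu cv =
    entryColour-alternates _ cv
      (subst (λ r → entryColour r ≡ 1) (trans (cong [_]₄ p) ([1+m]₄ (toℕ i′))) cu)
  consecutive-entries-not-both-colour-1 {_ , suc _} (() , _)
  consecutive-entries-not-both-colour-1 {_ , zero} {_ , suc _} (_ , () , _)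

  colour-0-packed : ∀ {u v d} → colour u ≡ 0 → colour v ≡ 0 → u ≢ v → Walk G u v d → d ≤ 1 → ⊥
  colour-0-packed _ _ u≢v here _ = u≢v refl
  colour-0-packed {u} {v} cu cv _ p@(step _ here) _ =
    odd-walk-changes-side side edge-flips-side p refl
      (trans (colour≡0⇒odd u cu) (sym (colour≡0⇒odd v cv)))
  colour-0-packed _ _ _ (step _ (step _ _)) (s≤s ())

  colour-1-packed : ∀ {u v d} → colour u ≡ 1 → colour v ≡ 1 → u ≢ v → Walk G u v d → d ≤ 2 → ⊥
  colour-1-packed {u} {v} cu cv u≢v p d≤2 =
    [ (λ j≡1 → case position-at j≡1 of λ ())
    , (λ entries → consecutive-entries-not-both-colour-1 entries cu cv)
    ]′ (short-walk-same-position (trans pu (sym (colour≡1⇒position≡0 v cv))) u≢v p (≤-trans d≤2 (n≤1+n 2)))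
    where
    pu : position u ≡ 0₄
    pu = colour≡1⇒position≡0 u cu
    position-at : ∀ {m} → toℕ (proj₂ u) ≡ m → [ m ]₄ ≡ 0₄
    position-at j≡m = trans (sym (cong [_]₄ j≡m)) pu

  colour-2-packed : ∀ {u v d} → colour u ≡ 2 → colour v ≡ 2 → u ≢ v → Walk G u v d → d ≤ 3 → ⊥
  colour-2-packed {u} {v} cu cv u≢v p d≤3 =
    [ (λ j≡1 → case position-at j≡1 of λ ())
    , (λ (j≡0 , _) → case position-at j≡0 of λ ())
    ]′ (short-walk-same-position (trans pu (sym (colour≡2⇒position≡2 v cv))) u≢v p d≤3)
    where
    pu : position u ≡ 2₄
    pu = colour≡2⇒position≡2 u cu
    position-at : ∀ {m} → toℕ (proj₂ u) ≡ m → [ m ]₄ ≡ 2₄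
    position-at j≡m = trans (sym (cong [_]₄ j≡m)) pu

  high-colour-packed : ∀ {u v d c} → 3 ≤ c → colour u ≡ c → colour v ≡ c → u ≢ v → Walk G u v d →
                       d ≤ suc c → ⊥
  high-colour-packed {_ , suc _} 3≤c cu _ _ _ _ = ≤⇒≯ (subst (_≤ 2) cu (cycleColour≤2 _)) 3≤c
  high-colour-packed {_ , zero} {_ , suc _} 3≤c _ cv _ _ _ = ≤⇒≯ (subst (_≤ 2) cv (cycleColour≤2 _)) 3≤c
  high-colour-packed {i , zero} {i′ , zero} {d} 3≤c cu cv u≢v p d≤1+c =
    u≢v (cong (_, zero) (toℕ-injective ([]₄-injective-within-3 copies-close same-copy-residue)))
    where
    same-copy-residue : [ toℕ i ]₄ ≡ [ toℕ i′ ]₄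
    same-copy-residue = entryColour-injective (subst (3 ≤_) (sym cu) 3≤c) (trans cu (sym cv))
    d≤5 : d ≤ 5
    d≤5 = ≤-trans d≤1+c (s≤s (subst (_≤ 4) cu (entryColour≤4 _)))
    copies-close : ∣ toℕ i - toℕ i′ ∣ ≤ 3
    copies-close = <⇒≤ (*-cancelˡ-< 2 _ 3 (s≤s (≤-trans (entries-apart p) d≤5)))

  colour-packed : ∀ u v → u ≢ v → colour u ≡ colour v → ¬ DistLe G u v (suc (colour u))
  colour-packed u v u≢v same (d , d≤ , p) with colour u in cu
  ... | 0                 = colour-0-packed cu (sym same) u≢v p d≤
  ... | 1                 = colour-1-packed cu (sym same) u≢v p d≤
  ... | 2                 = colour-2-packed cu (sym same) u≢v p d≤
  ... | suc (suc (suc k)) = high-colour-packed (m≤m+n 3 k) cu (sym same) u≢v p d≤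

  colourable : ∀ {K} → (∀ u → colour u < K) → PackingColorable G K
  colourable colour<K = packingColorable-fromℕ colour colour<K colour-packed

  colour-bound : ∀ {K} → 3 ≤ K → (∀ (i : Fin t) → entryColour [ toℕ i ]₄ < K) → ∀ u → colour u < K
  colour-bound _   entry<K (i , zero)  = entry<K i
  colour-bound 3≤K _       (_ , suc _) = ≤-trans (s≤s (cycleColour≤2 _)) 3≤K

  colour<5 : ∀ u → colour u < 5
  colour<5 = colour-bound (s≤s (s≤s (s≤s z≤n))) (λ i → s≤s (entryColour≤4 _))

  colour<4 : t ≤ 3 → ∀ u → colour u < 4
  colour<4 t≤3 = colour-bound (n≤1+n 3) λ i →
    s≤s (entryColour-first-three (toℕ i) (≤-pred (≤-trans (toℕ<n i) t≤3)))

  colour<3 : t ≤ 1 → ∀ u → colour u < 3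
  colour<3 t≤1 = colour-bound ≤-refl λ i →
    subst (λ m → entryColour [ m ]₄ < 3) (sym (n≤0⇒n≡0 (≤-pred (≤-trans (toℕ<n i) t≤1)))) (s≤s (s≤s z≤n))

no-packing-2-colouring : ∀ {t n} → 1 ≤ t → 4 ≤ n → ¬ PackingColorable (PDAdj t n) 2
no-packing-2-colouring {suc t} {suc (suc (suc (suc k)))} _ (s≤s (s≤s (s≤s (s≤s _)))) (_ , pc) =
  path-not-packing-2-colourable (PDAdj-irreflexive (s≤s (s≤s z≤n))) pc a₀a₁ a₁a₂ a₂a₃ (λ ()) (λ ())
  where
  G : PDV (suc t) (4 + k) → PDV (suc t) (4 + k) → Set
  G = PDAdj (suc t) (4 + k)
  a₀ a₁ a₂ a₃ : PDV (suc t) (4 + k)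
  a₀ = zero , zero
  a₁ = zero , suc zero
  a₂ = zero , suc (suc zero)
  a₃ = zero , suc (suc (suc zero))
  a₀a₁ : G a₀ a₁
  a₀a₁ = step⇒adj (along refl)
  a₁a₂ : G a₁ a₂
  a₁a₂ = step⇒adj (along refl)
  a₂a₃ : G a₂ a₃
  a₂a₃ = step⇒adj (along refl)

module _ {t k : ℕ} {c : PDV (2 + t) (4 + k) → Fin 3}
         (pc : IsPackingColoring (PDAdj (2 + t) (4 + k)) 3 c) where

  private
    G : PDV (2 + t) (4 + k) → PDV (2 + t) (4 + k) → Set
    G = PDAdj (2 + t) (4 + k)

    irr : Irreflexive _≡_ G
    irr = PDAdj-irreflexive (s≤s (s≤s z≤n))

    a₀ a₁ a₂ a₃ b₀ b₁ b₂ b₋₁ : PDV (2 + t) (4 + k)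
    a₀  = zero , zero
    a₁  = zero , suc zero
    a₂  = zero , suc (suc zero)
    a₃  = zero , suc (suc (suc zero))
    b₀  = suc zero , zero
    b₁  = suc zero , suc zero
    b₂  = suc zero , suc (suc zero)
    b₋₁ = suc zero , fromℕ (3 + k)

    a₁a₀ : G a₁ a₀
    a₁a₀ = step⇒adj˘ (along refl)
    a₁a₂ : G a₁ a₂
    a₁a₂ = step⇒adj (along refl)
    a₂a₃ : G a₂ a₃
    a₂a₃ = step⇒adj (along refl)
    a₁b₀ : G a₁ b₀
    a₁b₀ = step⇒adj˘ (bridge refl refl refl)
    b₀a₁ : G b₀ a₁
    b₀a₁ = step⇒adj (bridge refl refl refl)
    b₀b₁ : G b₀ b₁
    b₀b₁ = step⇒adj (along refl)
    b₁b₂ : G b₁ b₂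
    b₁b₂ = step⇒adj (along refl)
    b₀b₋₁ : G b₀ b₋₁
    b₀b₋₁ = step⇒adj˘ (wrap (toℕ-fromℕ (3 + k)) refl)

  bridge-not-packing-3-coloured : ⊥
  bridge-not-packing-3-coloured with c a₁ in ca₁ | c b₀ in cb₀
  ... | zero           | _              =
    claw-centre-colour≢0 irr PDAdj-sym pc a₁a₀ a₁a₂ a₁b₀ (λ ()) (λ ()) (λ ()) ca₁
  ... | _              | zero           =
    claw-centre-colour≢0 irr PDAdj-sym pc b₀a₁ b₀b₁ b₀b₋₁ (λ ()) (λ ()) (λ ()) cb₀
  ... | suc zero       | suc zero       = adjacent-colours-differ pc irr a₁b₀ (trans ca₁ (sym cb₀))
  ... | suc (suc zero) | suc (suc zero) = adjacent-colours-differ pc irr a₁b₀ (trans ca₁ (sym cb₀))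
  ... | suc (suc zero) | suc zero       =
    path-cannot-start-with-colours-2-1 irr pc ca₁ cb₀ a₁b₀ b₀b₁ b₁b₂ (λ ()) (λ ()) (λ ())
  ... | suc zero       | suc (suc zero) =
    path-cannot-start-with-colours-2-1 irr pc cb₀ ca₁ b₀a₁ a₁a₂ a₂a₃ (λ ()) (λ ()) (λ ())

no-packing-3-colouring : ∀ {t n} → 2 ≤ t → 4 ≤ n → ¬ PackingColorable (PDAdj t n) 3
no-packing-3-colouring (s≤s (s≤s _)) (s≤s (s≤s (s≤s (s≤s _)))) (_ , pc) =
  bridge-not-packing-3-coloured pc

theorem1 : (s t : ℕ) → 1 ≤ s → 1 ≤ t →
    (t ≡ 1 → PackingChromaticNumber (PDAdj t (4 * s)) 3) ×
    (2 ≤ t → t ≤ 3 → PackingChromaticNumber (PDAdj t (4 * s)) 4) ×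
    (4 ≤ t → PackingColorable (PDAdj t (4 * s)) 5)
theorem1 (suc s) t _ 1≤t = χ≡3 , χ≡4 , λ _ → colourable colour<5
  where
  open PackingColouring t s
  4≤n : 4 ≤ n
  4≤n = m≤m*n 4 (suc s)
  χ≡3 : t ≡ 1 → PackingChromaticNumber G 3
  χ≡3 refl =
    packingChromaticNumber-intro (colourable (colour<3 ≤-refl)) (no-packing-2-colouring 1≤t 4≤n)
  χ≡4 : 2 ≤ t → t ≤ 3 → PackingChromaticNumber G 4
  χ≡4 2≤t t≤3 =
    packingChromaticNumber-intro (colourable (colour<4 t≤3)) (no-packing-3-colouring 2≤t 4≤n)
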